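{- Let $G$ be an absolute semiradial with root $r$. Then for any subgraph $H$ of $G$ with $H\neq G$ that is an absolute semiradial with root $r$, there is a diear (in $G$) relative to $H$. Furthermore, if $V(H)\subsetneq V(G)$, then there is a diear relative to $H$ that has a vertex in $V(G)\setminus V(H)$.
   Context: A bidirected graph $G$ is a finite graph (loops and parallel edges allowed) with maps $\partial_+,\partial_-:E(G)\to 2^{V(G)}$ such that for each edge $e$ with (possibly identical) ends $u,v$: $\partial_\alpha(e)\subseteq\{u,v\}$, $\partial_+(e)\cup\partial_-(e)=\{u,v\}$, and $\partial_+(e)\cap\partial_-(e)=\emptyset$ if $e$ is not a loop. If $u\in\partial_\alpha(e)$, the sign of $u$ over $e$ is $\alpha$; $-\alpha$ denotes the opposite sign. A walk is a sequence $W=(w_1,\dots,w_k)$, $k$ odd, with $w_i$ a vertex for odd $i$ and $w_i$ an edge joining $w_{i-1},w_{i+1}$ for even $i$; closed over $r$ if $w_1=w_k=r$; a trail has no repeated edge. $W$ is a diwalk if to each traversal of an edge $w_i$ ($i$ even) one can assign signs to its end-occurrences $w_{i-1},w_{i+1}$ equal to the signs of these vertices over $w_i$ (for a loop with one end $+$ and the other $-$, the two assigned signs are distinct), such that at every internal vertex term the signs assigned from the preceding and following edges are distinct. A ditrail is a diwalk that is a trail. For $k\ge3$ the sign of $w_1$ (resp. $w_k$) over $W$ is the sign assigned at $w_2$ (resp. $w_{k-1}$); $W$ is an $(\alpha,\beta)$-ditrail if these are $\alpha,\beta$, and an $\alpha$-ditrail if it is an $(\alpha,\beta)$-ditrail for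 some $\beta$; the trivial ditrail $(v)$ counts as both a $(+,-)$- and a $(-,+)$-ditrail. $G$ is an $\alpha$-semiradial with root $r$ if every vertex has an $\alpha$-ditrail to $r$; an absolute semiradial with root $r$ if this holds for both $\alpha\in\{+,-\}$. For a subgraph $H$, a diear relative to $H$ is a diwalk $W$ whose ends lie in $V(H)$, whose edges are not edges of $H$, and which either (i) is a ditrail, or (ii) has the form $(v,e,w_3,\dots,w_{k-2},e,v)$, $k\ge7$, where $e$ joins a vertex of $V(H)$ to a vertex outside $V(H)$ and $(w_3,\dots,w_{k-2})$ is a closed ditrail not containing $e$. -}

module Defs where

open import Data.Nat using (ℕ)
open import Data.Fin using (Fin)
open import Data.Fin.Subset using (Subset; _∈_; _∉_) renaming (⊤ to full)
open import Data.Bool using (Bool; true; false)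
open import Data.List using (List; []; _∷_; map; [_]; _++_)
open import Data.List.Relation.Unary.All using (All)
open import Data.List.Relation.Unary.Any using (Any)
open import Data.List.Relation.Unary.Unique.Propositional using (Unique)
open import Data.List.Membership.Propositional using () renaming (_∈_ to _∈ₗ_; _∉_ to _∉ₗ_)
open import Data.Product using (Σ; _×_; _,_; ∃)
open import Data.Sum using (_⊎_)
open import Data.Unit using (⊤)
open import Data.Empty using (⊥)
open import Relation.Nullary using (¬_)
open import Relation.Binary.PropositionalEquality using (_≡_; _≢_)

data Sign : Set where
  plus minus : Sign

-- For a non-loop, the sign of end₁ e over e is sign₁ e, etc.
-- For a loop at u: (plus,plus) means ∂₊ = {u}, ∂₋ = ∅; (minus,minus) the reverse;
-- (plus,minus) or (minus,plus) means ∂₊ = ∂₋ = {u}.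
record BiGraph (n m : ℕ) : Set where
  field
    end₁ end₂   : Fin m → Fin n
    sign₁ sign₂ : Fin m → Sign
open BiGraph public

-- A traversal of an edge: the edge, and whether it is traversed from end₁ to end₂ (true)
-- or from end₂ to end₁ (false).  The direction fixes the sign assignment of the traversal.
record Step (m : ℕ) : Set where
  constructor step
  field
    edge : Fin m
    fwd  : Bool
open Step public

module _ {n m : ℕ} (G : BiGraph n m) where

  tailV headV : Step m → Fin n
  tailV (step e true)  = end₁ G e
  tailV (step e false) = end₂ G e
  headV (step e true)  = end₂ G e
  headV (step e false) = end₁ G e

  tailS headS : Step m → Sign
  tailS (step e true)  = sign₁ G e
  tailS (step e false) = sign₂ G e
  headS (step e true)  = sign₂ G e
  headS (step e false) = sign₁ G e

  -- A walk (w₁,…,w_k) is given by its start vertex and the list of edge traversals.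
  IsWalk : Fin n → List (Step m) → Set
  IsWalk v []       = ⊤
  IsWalk v (s ∷ ss) = tailV s ≡ v × IsWalk (headV s) ss

  endV : Fin n → List (Step m) → Fin n
  endV v []       = v
  endV v (s ∷ ss) = endV (headV s) ss

  Alternating : List (Step m) → Set
  Alternating []             = ⊤
  Alternating (s ∷ [])       = ⊤
  Alternating (s ∷ t ∷ ss)   = headS s ≢ tailS t × Alternating (t ∷ ss)

  IsDiwalk : Fin n → List (Step m) → Set
  IsDiwalk v ss = IsWalk v ss × Alternating ss

  edgesOf : List (Step m) → List (Fin m)
  edgesOf = map edge

  IsDitrail : Fin n → List (Step m) → Set
  IsDitrail v ss = IsDiwalk v ss × Unique (edgesOf ss)

  StartSign : List (Step m) → Sign → Set
  StartSign []      α = ⊥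
  StartSign (s ∷ _) α = tailS s ≡ α

  verticesOf : Fin n → List (Step m) → List (Fin n)
  verticesOf v []       = v ∷ []
  verticesOf v (s ∷ ss) = v ∷ verticesOf (headV s) ss

  -- an α-ditrail from v to r inside the subgraph (VH , EH):
  -- the trivial ditrail counts as an α-ditrail for both α
  HasDitrailTo : Subset n → Subset m → Sign → Fin n → Fin n → Set
  HasDitrailTo VH EH α v r =
    Σ (List (Step m)) λ ss →
      IsDitrail v ss × endV v ss ≡ r × All (λ e → e ∈ EH) (edgesOf ss)
      × (ss ≡ [] ⊎ StartSign ss α)

  AbsSemiradial : Subset n → Subset m → Fin n → Set
  AbsSemiradial VH EH r =
    r ∈ VH × ((v : Fin n) → v ∈ VH → (α : Sign) → HasDitrailTo VH EH α v r)

  IsSubgraph : Subset n → Subset m → Set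
  IsSubgraph VH EH = (e : Fin m) → e ∈ EH → end₁ G e ∈ VH × end₂ G e ∈ VH

  rev : Step m → Step m
  rev (step e b) = step e (Data.Bool.not b)

  -- shape (ii) of a diear: (v, e, w₃, …, w_{k-2}, e, v), k ≥ 7,
  -- e joins a vertex of V(H) to a vertex outside V(H),
  -- (w₃,…,w_{k-2}) a (nontrivial) closed ditrail not containing e.
  ShapeII : Subset n → Fin n → List (Step m) → Set
  ShapeII VH v ss =
    Σ (Step m) λ s → Σ (List (Step m)) λ inner →
      ss ≡ (s ∷ inner ++ [ rev s ]) × inner ≢ []
      × ((end₁ G (edge s) ∈ VH × end₂ G (edge s) ∉ VH)
         ⊎ (end₂ G (edge s) ∈ VH × end₁ G (edge s) ∉ VH))
      × IsDitrail (headV s) inner × endV (headV s) inner ≡ headV s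
      × edge s ∉ₗ edgesOf inner

  IsDiear : Subset n → Subset m → Fin n → List (Step m) → Set
  IsDiear VH EH v ss =
    IsDiwalk v ss × ss ≢ [] × v ∈ VH × endV v ss ∈ VH
    × All (λ e → e ∉ EH) (edgesOf ss)
    × (Unique (edgesOf ss) ⊎ ShapeII VH v ss)

module Submission where

-- The heart of the proof is the case of a vertex u outside V(H).  A ditrail
-- from u to r ∈ V(H) must enter V(H); reversing its last traversal gives a
-- traversal t leaving V(H) towards a vertex w ∉ V(H), over which w has some
-- sign β.  Because G is absolute, w has a (-β)-ditrail P to r; cut it at its
-- first vertex in V(H).  If P avoids the edge of t, then t followed by P is a
-- diear of shape (i).  Otherwise P uses that edge a first time; the traversal
-- then starts outside V(H), so it is t reversed, and the signs forbid it to be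
-- the first traversal of P.  Hence P = A ++ (t reversed) ∷ B with A a
-- nonempty closed ditrail at w avoiding the edge of t, and
-- t ∷ A ++ [t reversed] is a diear of shape (ii).
--
-- If V(H) = V(G), then H ≠ G forces an edge outside E(H); as a subgraph
-- contains both ends of that edge, the edge alone is a diear of shape (i).

open import Defs
open import Data.Nat using (ℕ)
open import Data.Fin using (Fin)
open import Data.Fin.Properties using () renaming (_≟_ to _≟ᶠ_)
open import Data.Fin.Subset using (Subset; _∈_; _∉_; ∁; Empty) renaming (⊤ to full)
open import Data.Fin.Subset.Properties
  using (_∈?_; ∈⊤; ⊆⊤; ⊆-antisym; nonempty?; x∈∁p⇒x∉p; x∉∁p⇒x∈p)
open import Data.Bool using (true; false)
open import Data.List using (List; []; _∷_; _++_; [_])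
open import Data.List.Properties using (++-assoc)
open import Data.List.Relation.Unary.Any using (Any; here; there)
open import Data.List.Relation.Unary.All using (All; []; _∷_)
import Data.List.Relation.Unary.All as All
open import Data.List.Relation.Unary.All.Properties using (map⁺; map⁻; ++⁺; ++⁻ˡ; ++⁻ʳ; All¬⇒¬Any)
open import Data.List.Relation.Unary.AllPairs using ([]; _∷_)
open import Data.List.Relation.Unary.Unique.Propositional using (Unique)
open import Data.List.Relation.Unary.First using (first)
import Data.List.Relation.Unary.First as First
open import Data.List.Relation.Unary.First.Properties using (toView)
open import Data.Product using (Σ; _×_; _,_; proj₁; proj₂) renaming (swap to ×-swap)
open import Data.Sum using (_⊎_; inj₁; inj₂) renaming (swap to ⊎-swap)
open import Data.Unit using (tt)
open import Data.Empty using (⊥-elim)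
open import Relation.Nullary using (¬_; yes; no)
open import Relation.Nullary.Decidable using (toSum)
open import Relation.Binary.PropositionalEquality using (_≡_; _≢_; refl; sym; trans; subst)

opp : Sign → Sign
opp plus  = minus
opp minus = plus

opp-irrefl : (β : Sign) → β ≢ opp β
opp-irrefl plus  ()
opp-irrefl minus ()

∁-empty⇒full : {n : ℕ} {p : Subset n} → Empty (∁ p) → p ≡ full
∁-empty⇒full {p = p} none = ⊆-antisym ⊆⊤ in-p
  where
  in-p : ∀ {x} → x ∈ full → x ∈ p
  in-p {x} _ = x∉∁p⇒x∈p (λ x∈∁p → none (x , x∈∁p))

module _ {n m : ℕ} (G : BiGraph n m) where

  tail-rev : (s : Step m) → tailV G (rev G s) ≡ headV G s
  tail-rev (step e true)  = refl
  tail-rev (step e false) = refl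

  head-rev : (s : Step m) → headV G (rev G s) ≡ tailV G s
  head-rev (step e true)  = refl
  head-rev (step e false) = refl

  tailS-rev : (s : Step m) → tailS G (rev G s) ≡ headS G s
  tailS-rev (step e true)  = refl
  tailS-rev (step e false) = refl

  endV-snoc : (v : Fin n) (xs : List (Step m)) (y : Step m) → endV G v (xs ++ [ y ]) ≡ headV G y
  endV-snoc v []       y = refl
  endV-snoc v (x ∷ xs) y = endV-snoc (headV G x) xs y

  walk-++⁻ˡ : (v : Fin n) (xs : List (Step m)) {ys : List (Step m)} → IsWalk G v (xs ++ ys) → IsWalk G v xs
  walk-++⁻ˡ v []       w        = tt
  walk-++⁻ˡ v (x ∷ xs) (eq , w) = eq , walk-++⁻ˡ (headV G x) xs w

  walk-++⁻ʳ : (v : Fin n) (xs : List (Step m)) {ys : List (Step m)} → IsWalk G v (xs ++ ys) → IsWalk G (endV G v xs) ys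
  walk-++⁻ʳ v []       w       = w
  walk-++⁻ʳ v (x ∷ xs) (_ , w) = walk-++⁻ʳ (headV G x) xs w

  alternating-++⁻ˡ : (xs : List (Step m)) {ys : List (Step m)} → Alternating G (xs ++ ys) → Alternating G xs
  alternating-++⁻ˡ []           a       = tt
  alternating-++⁻ˡ (x ∷ [])     a       = tt
  alternating-++⁻ˡ (x ∷ y ∷ xs) (d , a) = d , alternating-++⁻ˡ (y ∷ xs) a

  unique-++⁻ˡ : (xs : List (Step m)) {ys : List (Step m)} → Unique (edgesOf G (xs ++ ys)) → Unique (edgesOf G xs)
  unique-++⁻ˡ []       u       = []
  unique-++⁻ˡ (x ∷ xs) (d ∷ u) = map⁺ (++⁻ˡ xs (map⁻ d)) ∷ unique-++⁻ˡ xs u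

  diwalk-++⁻ˡ : (v : Fin n) (xs : List (Step m)) {ys : List (Step m)} → IsDiwalk G v (xs ++ ys) → IsDiwalk G v xs
  diwalk-++⁻ˡ v xs (w , a) = walk-++⁻ˡ v xs w , alternating-++⁻ˡ xs a

  ditrail-++⁻ˡ : (v : Fin n) (xs : List (Step m)) {ys : List (Step m)} → IsDitrail G v (xs ++ ys) → IsDitrail G v xs
  ditrail-++⁻ˡ v xs (d , u) = diwalk-++⁻ˡ v xs d , unique-++⁻ˡ xs u

  diwalk-∷ : (t : Step m) (ss : List (Step m)) → IsDiwalk G (headV G t) ss
    → StartSign G ss (opp (headS G t)) → IsDiwalk G (tailV G t) (t ∷ ss)
  diwalk-∷ t (s ∷ ss) (w , a) start = (refl , w) , (λ eq → opp-irrefl (headS G t) (trans eq start)) , a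

  module _ (VH : Subset n) where

    EntryDitrail : Sign → Fin n → List (Step m) → Set
    EntryDitrail α v ss =
      IsDitrail G v ss × StartSign G ss α × All (λ s → tailV G s ∉ VH) ss × endV G v ss ∈ VH

    crossing-ends : (t : Step m) → tailV G t ∈ VH → headV G t ∉ VH →
      (end₁ G (edge t) ∈ VH × end₂ G (edge t) ∉ VH) ⊎ (end₂ G (edge t) ∈ VH × end₁ G (edge t) ∉ VH)
    crossing-ends (step e true)  i o = inj₁ (i , o)
    crossing-ends (step e false) i o = inj₂ (i , o)

    same-edge-reversed : (t t′ : Step m) → edge t ≡ edge t′ → tailV G t ∈ VH → tailV G t′ ∉ VH → t′ ≡ rev G t
    same-edge-reversed (step e true)  (step .e true)  refl i o = ⊥-elim (o i)
    same-edge-reversed (step e true)  (step .e false) refl i o = refl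
    same-edge-reversed (step e false) (step .e true)  refl i o = refl
    same-edge-reversed (step e false) (step .e false) refl i o = ⊥-elim (o i)

    first-entry : (v : Fin n) (ss : List (Step m)) → IsWalk G v ss → v ∉ VH → endV G v ss ∈ VH
      → Σ (List (Step m)) λ pre → Σ (List (Step m)) λ post →
          ss ≡ pre ++ post × All (λ s → tailV G s ∉ VH) pre × endV G v pre ∈ VH
    first-entry v []       _        o i = ⊥-elim (o i)
    first-entry v (s ∷ ss) (eq , w) o i with headV G s ∈? VH
    ... | yes h = [ s ] , ss , refl , subst (_∉ VH) (sym eq) o ∷ [] , h
    ... | no h with first-entry (headV G s) ss w h i
    ...   | pre , post , refl , tails , end = s ∷ pre , post , refl , subst (_∉ VH) (sym eq) o ∷ tails , end

    entry-ditrail : {α : Sign} {v r : Fin n} → r ∈ VH → v ∉ VH → HasDitrailTo G full full α v r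
      → Σ (List (Step m)) λ pre → EntryDitrail α v pre
    entry-ditrail {α} {v} r∈ v∉ (ss , ditrail@((w , _) , _) , refl , _ , start)
      with first-entry v ss w v∉ r∈
    ... | []        , _    , refl , _     , end = ⊥-elim (v∉ end)
    ... | (s ∷ pre) , post , refl , tails , end =
      s ∷ pre , ditrail-++⁻ˡ v (s ∷ pre) ditrail , nontrivial start , tails , end
      where
      nontrivial : (s ∷ pre ++ post) ≡ [] ⊎ StartSign G (s ∷ pre ++ post) α → tailS G s ≡ α
      nontrivial (inj₁ ())
      nontrivial (inj₂ st) = st

    leaving-step : (s : Step m) (ss : List (Step m)) → All (λ x → tailV G x ∉ VH) (s ∷ ss)
      → endV G (headV G s) ss ∈ VH → Σ (Step m) λ t → tailV G t ∈ VH × headV G t ∉ VH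
    leaving-step s []        (o ∷ []) i =
      rev G s , subst (_∈ VH) (sym (tail-rev s)) i , subst (_∉ VH) (sym (head-rev s)) o
    leaving-step s (s′ ∷ ss) (_ ∷ os) i = leaving-step s′ ss os i

    module _ (EH : Subset m) where

      DiearOutside : Set
      DiearOutside = Σ (Fin n) λ v → Σ (List (Step m)) λ ss →
        IsDiear G VH EH v ss × Any (λ w → w ∉ VH) (verticesOf G v ss)

      single-edge-diear : (e : Fin m) → e ∉ EH → end₁ G e ∈ VH → end₂ G e ∈ VH
        → IsDiear G VH EH (end₁ G e) [ step e true ]
      single-edge-diear e e∉ i₁ i₂ = ((refl , tt) , tt) , (λ ()) , i₁ , i₂ , e∉ ∷ [] , inj₁ ([] ∷ [])

      module _ (sub : IsSubgraph G VH EH) where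

        step-in-H : (s : Step m) → edge s ∈ EH → tailV G s ∈ VH × headV G s ∈ VH
        step-in-H (step e true)  e∈ = sub e e∈
        step-in-H (step e false) e∈ = ×-swap (sub e e∈)

        tail-outside : (s : Step m) → tailV G s ∉ VH → edge s ∉ EH
        tail-outside s o e∈ = o (proj₁ (step-in-H s e∈))

        head-outside : (s : Step m) → headV G s ∉ VH → edge s ∉ EH
        head-outside s o e∈ = o (proj₂ (step-in-H s e∈))

        returning-diear : (t : Step m) → tailV G t ∈ VH → headV G t ∉ VH
          → (A B : List (Step m)) → A ≢ []
          → EntryDitrail (opp (headS G t)) (headV G t) (A ++ rev G t ∷ B)
          → All (λ s → edge t ≢ edge s) A → DiearOutside
        returning-diear t t∈ w∉ []      B A≢[] _ _ = ⊥-elim (A≢[] refl)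
        returning-diear t t∈ w∉ (a ∷ A) B _ (ditrail@((walk , _) , _) , start , tails , _) avoid =
          tailV G t , t ∷ loop ,
          (diwalk-∷ t loop loop-diwalk start , (λ ()) , t∈ , loop-end , map⁺ loop-edges ,
            inj₂ (t , a ∷ A , refl , (λ ()) , crossing-ends t t∈ w∉ ,
                  ditrail-++⁻ˡ w (a ∷ A) ditrail , closed , All¬⇒¬Any (map⁺ avoid))) ,
          there (here w∉)
          where
          w = headV G t
          loop = a ∷ A ++ [ rev G t ]
          loop-diwalk : IsDiwalk G w loop
          loop-diwalk = diwalk-++⁻ˡ w loop (subst (IsDiwalk G w) (sym (++-assoc (a ∷ A) [ rev G t ] B)) (proj₁ ditrail))
          loop-end : endV G w loop ∈ VH
          loop-end = subst (_∈ VH) (sym (trans (endV-snoc w (a ∷ A) (rev G t)) (head-rev t))) t∈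
          loop-edges : All (λ s → edge s ∉ EH) (t ∷ loop)
          loop-edges = head-outside t w∉ ∷ All.map (λ {s} → tail-outside s)
            (++⁺ (++⁻ˡ (a ∷ A) tails) (subst (_∉ VH) (sym (tail-rev t)) w∉ ∷ []))
          closed : endV G w (a ∷ A) ≡ w
          closed = trans (sym (proj₁ (walk-++⁻ʳ w (a ∷ A) walk))) (tail-rev t)

        diear-from-leaving-step : (t : Step m) → tailV G t ∈ VH → headV G t ∉ VH
          → (pre : List (Step m)) → EntryDitrail (opp (headS G t)) (headV G t) pre → DiearOutside
        diear-from-leaving-step t t∈ w∉ pre entry@(_ , start , tails , _)
          with first (λ s → ⊎-swap (toSum (edge t ≟ᶠ edge s))) pre
        ... | inj₁ uses-edge with toView uses-edge
        ...   | First._++_∷_ {A} {t′} avoid same B with same-edge-reversed t t′ same t∈ (All.head (++⁻ʳ A tails))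
        ...     | refl = returning-diear t t∈ w∉ A B A≢[] entry avoid
          where
          A≢[] : A ≢ []
          A≢[] refl = opp-irrefl (headS G t) (trans (sym (tailS-rev t)) start)
        diear-from-leaving-step t t∈ w∉ (s ∷ pre) (((walk , alt) , unique) , start , tails , end) | inj₂ avoid =
          tailV G t , t ∷ s ∷ pre ,
          (diwalk-∷ t (s ∷ pre) (walk , alt) start , (λ ()) , t∈ , end ,
            map⁺ ear-edges , inj₁ (map⁺ avoid ∷ unique)) ,
          there (here w∉)
          where
          ear-edges : All (λ x → edge x ∉ EH) (t ∷ s ∷ pre)
          ear-edges = head-outside t w∉ ∷ All.map (λ {x} → tail-outside x) tails

        -- Through every vertex outside VH passes a diear.
        diear-through-outside-vertex : (r : Fin n) → AbsSemiradial G full full r → r ∈ VH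
          → (u : Fin n) → u ∉ VH → DiearOutside
        diear-through-outside-vertex r (_ , reach) r∈ u u∉ with entry-ditrail r∈ u∉ (reach u ∈⊤ plus)
        ... | s ∷ ss , _ , _ , tails , end with leaving-step s ss tails end
        ...   | t , t∈ , w∉ with entry-ditrail r∈ w∉ (reach (headV G t) ∈⊤ (opp (headS G t)))
        ...     | pre , entry = diear-from-leaving-step t t∈ w∉ pre entry

lemma8p5 : {n m : ℕ} (G : BiGraph n m) (r : Fin n)
    → AbsSemiradial G full full r
    → (VH : Subset n) (EH : Subset m)
    → IsSubgraph G VH EH
    → ¬ (VH ≡ full × EH ≡ full)
    → AbsSemiradial G VH EH r
    → (Σ (Fin n) λ v → Σ (List (Step m)) λ ss → IsDiear G VH EH v ss)
      × ((Σ (Fin n) λ u → u ∉ VH)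
         → Σ (Fin n) λ v → Σ (List (Step m)) λ ss →
             IsDiear G VH EH v ss × Any (λ w → w ∉ VH) (verticesOf G v ss))
lemma8p5 G r semi VH EH sub H≢G (r∈VH , _) = some-diear , outside-diear
  where
  outside-diear : (Σ (Fin _) λ u → u ∉ VH) → DiearOutside G VH EH
  outside-diear (u , u∉) = diear-through-outside-vertex G VH EH sub r semi r∈VH u u∉

  some-diear : Σ (Fin _) λ v → Σ (List (Step _)) λ ss → IsDiear G VH EH v ss
  some-diear with nonempty? (∁ VH) | nonempty? (∁ EH)
  ... | yes (u , u∈∁) | _ with outside-diear (u , x∈∁p⇒x∉p u∈∁)
  ...   | v , ss , diear , _ = v , ss , diear
  some-diear | no VH-full | yes (e , e∈∁) =
    end₁ G e , [ step e true ] , single-edge-diear G VH EH e (x∈∁p⇒x∉p e∈∁) (in-VH (end₁ G e)) (in-VH (end₂ G e))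
    where
    in-VH : ∀ x → x ∈ VH
    in-VH x = subst (x ∈_) (sym (∁-empty⇒full VH-full)) ∈⊤
  some-diear | no VH-full | no EH-full = ⊥-elim (H≢G (∁-empty⇒full VH-full , ∁-empty⇒full EH-full))
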